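{- Under the Modified CFLS coloring $\varphi$ of $K_n$ ($n=2^{m^2}$), there is no copy of $K_5$ which is a 2-2-2-2-2 coloring, contains a rainbow 5-cycle, and has at least one color class that is a matching.
   Context: Let $m$ be a positive integer and $n=2^{m^2}$. The vertices of $K_n$ are the binary strings $v\in\{0,1\}^{m^2}$, written as $v=(v^{(1)},\dots,v^{(m)})$ with each block $v^{(k)}\in\{0,1\}^m$. Vertices (and blocks) are linearly ordered as binary integers: $x<y$ iff at the first bit where they differ, $x$ has 0 and $y$ has 1. For $x<y$, let $i$ be the first index with $x^{(i)}\ne y^{(i)}$; for $k\in[m]$ let $i_k$ be the first position at which the bits of $x^{(k)}$ and $y^{(k)}$ differ ($i_k=0$ if $x^{(k)}=y^{(k)}$), and let $\delta_k=+1$ if $x^{(k)}\le y^{(k)}$ and $\delta_k=-1$ if $x^{(k)}>y^{(k)}$. The Modified CFLS coloring assigns to edge $xy$ the color $\varphi(xy)=((i,\{x^{(i)},y^{(i)}\}),i_1,\dots,i_m,\delta_1,\dots,\delta_m)$. A copy of $K_5$ is a 2-2-2-2-2 coloring if its ten edges receive exactly five colors, each on exactly two edges; each color class is then either a matching (two disjoint edges) or a path (two edges sharing a vertex). A rainbow 5-cycle is a 5-cycle whose five edges have distinct colors. -}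

module Defs where

open import Data.Nat using (ℕ; zero; suc)
open import Data.Bool using (Bool; true; false; if_then_else_; not)
open import Data.Bool.Properties using () renaming (_≟_ to _≟B_)
open import Data.Vec using (Vec; []; _∷_; concat; map; zipWith)
open import Data.Vec.Properties using (≡-dec)
open import Data.Fin using (Fin; _<_) renaming (zero to f0; suc to fs)
open import Data.Maybe using (Maybe; just; nothing)
open import Data.Product using (_×_; _,_; Σ; ∃; ∃-syntax)
open import Data.Sign using (Sign) renaming (+ to plus; - to minus)
open import Relation.Nullary using (¬_; does)
open import Relation.Binary.PropositionalEquality using (_≡_; _≢_)
open import Data.Sum using (_⊎_)
open import Function.Definitions using (Injective)

-- Bit strings; false = 0, true = 1.
Bits : ℕ → Set
Bits = Vec Bool

eqBit : Bool → Bool → Bool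
eqBit a b = does (a ≟B b)

-- Lexicographic (= binary-integer) order: x ≤ y.
lexLeq : ∀ {n} → Bits n → Bits n → Bool
lexLeq [] [] = true
lexLeq (a ∷ xs) (b ∷ ys) = if eqBit a b then lexLeq xs ys else not a

-- 1-based index of the first position where two bit strings differ; 0 if equal.
shiftPos : ℕ → ℕ
shiftPos zero = zero
shiftPos (suc k) = suc (suc k)

firstDiffPos : ∀ {n} → Bits n → Bits n → ℕ
firstDiffPos [] [] = zero
firstDiffPos (a ∷ xs) (b ∷ ys) = if eqBit a b then shiftPos (firstDiffPos xs ys) else 1

-- A vertex of K_n, n = 2^(m^2): m blocks of m bits each, v = (v^(1),...,v^(m)).
Vertex : ℕ → Set
Vertex m = Vec (Bits m) m

bitsOf : ∀ {m} → Vertex m → Bits _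
bitsOf = concat

vLeq : ∀ {m} → Vertex m → Vertex m → Bool
vLeq x y = lexLeq (bitsOf x) (bitsOf y)

-- Unordered pair of blocks {u,w}, represented canonically as (smaller, larger).
sortPair : ∀ {m} → Bits m → Bits m → Bits m × Bits m
sortPair u w = if lexLeq u w then (u , w) else (w , u)

-- First block index i (1-based) where x and y differ, together with {x^(i), y^(i)};
-- nothing if x = y.
firstDiffBlock : ∀ {m k} → Vec (Bits m) k → Vec (Bits m) k → ℕ → Maybe (ℕ × (Bits m × Bits m))
firstDiffBlock [] [] i = nothing
firstDiffBlock (u ∷ xs) (w ∷ ys) i =
  if does (≡-dec _≟B_ u w) then firstDiffBlock xs ys (suc i) else just (i , sortPair u w)

delta : ∀ {m} → Bits m → Bits m → Sign
delta u w = if lexLeq u w then plus else minus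

Color : ℕ → Set
Color m = Maybe (ℕ × (Bits m × Bits m)) × Vec ℕ m × Vec Sign m

-- Colour of the ordered pair (x,y), intended for x < y.
colorOrdered : ∀ {m} → Vertex m → Vertex m → Color m
colorOrdered x y = firstDiffBlock x y 1 , zipWith firstDiffPos x y , zipWith delta x y

φ : ∀ {m} → Vertex m → Vertex m → Color m
φ x y = if vLeq x y then colorOrdered x y else colorOrdered y x

-- Copies of K_5: an injective map f : Fin 5 → Vertex m.
-- Edges of K_5: pairs (a , b) with a < b.

Edge5 : Set
Edge5 = Σ (Fin 5 × Fin 5) (λ { (a , b) → a < b })

src tgt : Edge5 → Fin 5
src ((a , _) , _) = a
tgt ((_ , b) , _) = b

SameEdge : Edge5 → Edge5 → Set
SameEdge e e' = (src e ≡ src e') × (tgt e ≡ tgt e')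

edgeColor : ∀ {m} → (Fin 5 → Vertex m) → Edge5 → Color m
edgeColor f e = φ (f (src e)) (f (tgt e))

-- 2-2-2-2-2: the ten edges get exactly five colours, each on exactly two edges;
-- equivalently every edge shares its colour with exactly one other edge.
Is22222 : ∀ {m} → (Fin 5 → Vertex m) → Set
Is22222 f = ∀ e → ∃[ e' ] (¬ SameEdge e e' × edgeColor f e ≡ edgeColor f e'
                          × (∀ e'' → edgeColor f e ≡ edgeColor f e'' → SameEdge e e'' ⊎ SameEdge e' e''))

-- Some colour class is a matching: two distinct edges of the same colour sharing no vertex.
Disjoint : Edge5 → Edge5 → Set
Disjoint e e' = src e ≢ src e' × src e ≢ tgt e' × tgt e ≢ src e' × tgt e ≢ tgt e'

HasMatchingClass : ∀ {m} → (Fin 5 → Vertex m) → Set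
HasMatchingClass f = ∃[ e ] ∃[ e' ] (Disjoint e e' × edgeColor f e ≡ edgeColor f e')

-- Rainbow 5-cycle: a cyclic ordering σ(0),...,σ(4) of the five vertices such that
-- the five cycle edges σ(k)σ(k+1 mod 5) have pairwise distinct colours.
next5 : Fin 5 → Fin 5
next5 f0 = fs f0
next5 (fs f0) = fs (fs f0)
next5 (fs (fs f0)) = fs (fs (fs f0))
next5 (fs (fs (fs f0))) = fs (fs (fs (fs f0)))
next5 (fs (fs (fs (fs f0)))) = f0

cycleColor : ∀ {m} → (Fin 5 → Vertex m) → (Fin 5 → Fin 5) → Fin 5 → Color m
cycleColor f σ k = φ (f (σ k)) (f (σ (next5 k)))

HasRainbow5Cycle : ∀ {m} → (Fin 5 → Vertex m) → Set
HasRainbow5Cycle f = ∃[ σ ] (Injective _≡_ _≡_ σ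
                      × (∀ k l → k ≢ l → cycleColor f σ k ≢ cycleColor f σ l))

{-# OPTIONS --safe #-}
module Submission where

-- Two disjoint edges ab, cd of the same colour first differ in the same block i, and there
-- {a⁽ⁱ⁾, b⁽ⁱ⁾} = {c⁽ⁱ⁾, d⁽ⁱ⁾}; call these blocks α (at a, c) and β (at b, d), and let γ be the
-- i-th block of the fifth vertex e. The colour also records, in block i, the first position
-- where the endpoints differ, and for three strings two of these positions coincide while the
-- third differs. A rainbow 5-cycle uses each colour at most once, so it contains at most half
-- of any union of colour classes. If γ splits from α and β at the same position, the three
-- perfect matchings of {a, b, c, d} are colour classes, but deleting e from a Hamiltonian cycle
-- leaves a path whose end edges form one of them. Otherwise, up to swapping α and β, the
-- first-difference position of ab is shared exactly by the six edges between {b, d} and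
-- {a, c, e}; they form a union of colour classes, yet a 5-cycle uses either four of them or
-- three of the other four edges.

open import Defs
open import Data.Bool using (Bool; true; false; not; _∧_; _xor_; T)
open import Data.Bool.Properties using (T?) renaming (_≟_ to _≟B_)
open import Data.Empty using (⊥; ⊥-elim)
open import Data.Fin using (Fin; toℕ; punchOut) renaming (zero to 0F; suc to fs)
import Data.Fin as Fin
open import Data.Fin.Patterns using (1F; 2F; 3F; 4F)
open import Data.Fin.Permutation using (Permutation′; permutation; _⟨$⟩ʳ_; _⟨$⟩ˡ_; inverseˡ; inverseʳ)
open import Data.Fin.Properties
  using (_≟_; any?; all?; <-cmp; <-asym; <⇒≢; toℕ-injective; injective⇒≤; punchOut-injective)
open import Data.List using (List; []; _∷_; length; filter; allFin; cartesianProduct)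
open import Data.List.Properties using (length-removeAt′)
open import Data.List.Membership.Propositional using (_∈_; lose)
open import Data.List.Membership.Propositional.Properties
  using (∈-filter⁺; ∈-cartesianProduct⁺; ∈-allFin)
open import Data.List.Relation.Unary.All as All using (All; []; _∷_)
open import Data.List.Relation.Unary.All.Properties using (all-filter)
open import Data.List.Relation.Unary.AllPairs as AllPairs using (AllPairs; []; _∷_)
import Data.List.Relation.Unary.AllPairs.Properties as AllPairs
open import Data.List.Relation.Unary.Any as Any using (Any; here; there; _─_)
open import Data.List.Relation.Unary.Unique.Propositional.Properties using (allFin⁺)
open import Data.Maybe using (just)
open import Data.Maybe.Properties using (just-injective)
open import Data.Nat using (ℕ; zero; suc; _+_; _≤_; _<_; _<?_; z≤n; s≤s)
import Data.Nat as ℕ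
open import Data.Nat.Properties using (+-suc; +-cancelʳ-≡; 1+n≰n; <⇒≱; module ≤-Reasoning)
open import Data.Product using (_×_; _,_; proj₁; proj₂; Σ; ∃; ∃₂)
open import Data.Product.Properties using (,-injective)
open import Data.Sum using (_⊎_; inj₁; inj₂)
open import Data.Vec using (Vec; []; _∷_; lookup; concat)
open import Data.Vec.Properties using (++-injective; ≡-dec; lookup-zipWith)
open import Function using (_∘_)
open import Function.Bundles using (mk⇔)
open import Function.Definitions using (Injective)
open import Relation.Binary.Definitions using (tri<; tri≈; tri>)
open import Relation.Nullary using (¬_; Dec; does; yes; no; ¬?; contradiction)
open import Relation.Nullary.Decidable
  using (_×-dec_; _⊎-dec_; _→-dec_; map′; from-yes; dec-true; dec-false; does-⇔)
open import Relation.Binary.PropositionalEquality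

infix 4 _≐_

_≐_ : {A : Set} → A × A → A × A → Set
(u , v) ≐ (u' , v') = (u ≡ u' × v ≡ v') ⊎ (u ≡ v' × v ≡ u')

≐-refl : {A : Set} {p : A × A} → p ≐ p
≐-refl = inj₁ (refl , refl)

≐-flip : {A : Set} {u v : A} → (u , v) ≐ (v , u)
≐-flip = inj₂ (refl , refl)

≐-sym : {A : Set} {p q : A × A} → p ≐ q → q ≐ p
≐-sym (inj₁ (refl , refl)) = inj₁ (refl , refl)
≐-sym (inj₂ (refl , refl)) = inj₂ (refl , refl)

≐-trans : {A : Set} {p q r : A × A} → p ≐ q → q ≐ r → p ≐ r
≐-trans (inj₁ (refl , refl)) q≐r = q≐r
≐-trans (inj₂ (refl , refl)) (inj₁ (refl , refl)) = inj₂ (refl , refl)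
≐-trans (inj₂ (refl , refl)) (inj₂ (refl , refl)) = inj₁ (refl , refl)

≐-map : {A B : Set} (f : A → B) {u v u' v' : A} → (u , v) ≐ (u' , v') → (f u , f v) ≐ (f u' , f v')
≐-map f (inj₁ (refl , refl)) = inj₁ (refl , refl)
≐-map f (inj₂ (refl , refl)) = inj₂ (refl , refl)

shiftPos-injective : ∀ {a b} → shiftPos a ≡ shiftPos b → a ≡ b
shiftPos-injective {zero} {zero} _ = refl
shiftPos-injective {suc a} {suc b} refl = refl

shiftPos≢1 : ∀ k → shiftPos k ≢ 1
shiftPos≢1 zero ()
shiftPos≢1 (suc k) ()

firstDiffPos-self : ∀ {n} (x : Bits n) → firstDiffPos x x ≡ 0
firstDiffPos-self [] = refl
firstDiffPos-self (false ∷ x) rewrite firstDiffPos-self x = refl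
firstDiffPos-self (true ∷ x) rewrite firstDiffPos-self x = refl

firstDiffPos-sym : ∀ {n} (x y : Bits n) → firstDiffPos x y ≡ firstDiffPos y x
firstDiffPos-sym [] [] = refl
firstDiffPos-sym (false ∷ x) (false ∷ y) rewrite firstDiffPos-sym x y = refl
firstDiffPos-sym (false ∷ x) (true ∷ y) = refl
firstDiffPos-sym (true ∷ x) (false ∷ y) = refl
firstDiffPos-sym (true ∷ x) (true ∷ y) rewrite firstDiffPos-sym x y = refl

firstDiffPos≡0⇒≡ : ∀ {n} (x y : Bits n) → firstDiffPos x y ≡ 0 → x ≡ y
firstDiffPos≡0⇒≡ [] [] _ = refl
firstDiffPos≡0⇒≡ (false ∷ x) (false ∷ y) e =
  cong (false ∷_) (firstDiffPos≡0⇒≡ x y (shiftPos-injective e))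
firstDiffPos≡0⇒≡ (true ∷ x) (true ∷ y) e =
  cong (true ∷_) (firstDiffPos≡0⇒≡ x y (shiftPos-injective e))

-- a, b, c are the sides xy, zx, zy of a triangle xyz; the apex is where the two equal sides meet.
data Isosceles (a b c : ℕ) : Set where
  apex-z : b ≡ c → b ≢ a → Isosceles a b c
  apex-y : c ≡ a → b ≢ a → Isosceles a b c
  apex-x : b ≡ a → c ≢ a → Isosceles a b c

Isosceles-shiftPos : ∀ {a b c} → Isosceles a b c → Isosceles (shiftPos a) (shiftPos b) (shiftPos c)
Isosceles-shiftPos (apex-z e n) = apex-z (cong shiftPos e) (n ∘ shiftPos-injective)
Isosceles-shiftPos (apex-y e n) = apex-y (cong shiftPos e) (n ∘ shiftPos-injective)
Isosceles-shiftPos (apex-x e n) = apex-x (cong shiftPos e) (n ∘ shiftPos-injective)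

firstDiffPos-isosceles : ∀ {n} (x y z : Bits n) → x ≢ y →
                         Isosceles (firstDiffPos x y) (firstDiffPos z x) (firstDiffPos z y)
firstDiffPos-isosceles [] [] [] x≢y = ⊥-elim (x≢y refl)
firstDiffPos-isosceles (false ∷ x) (false ∷ y) (false ∷ z) x≢y =
  Isosceles-shiftPos (firstDiffPos-isosceles x y z (x≢y ∘ cong (false ∷_)))
firstDiffPos-isosceles (true ∷ x) (true ∷ y) (true ∷ z) x≢y =
  Isosceles-shiftPos (firstDiffPos-isosceles x y z (x≢y ∘ cong (true ∷_)))
firstDiffPos-isosceles (false ∷ x) (false ∷ y) (true ∷ z) _ = apex-z refl (shiftPos≢1 _ ∘ sym)
firstDiffPos-isosceles (true ∷ x) (true ∷ y) (false ∷ z) _ = apex-z refl (shiftPos≢1 _ ∘ sym)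
firstDiffPos-isosceles (false ∷ x) (true ∷ y) (false ∷ z) _ = apex-y refl (shiftPos≢1 _)
firstDiffPos-isosceles (true ∷ x) (false ∷ y) (true ∷ z) _ = apex-y refl (shiftPos≢1 _)
firstDiffPos-isosceles (false ∷ x) (true ∷ y) (true ∷ z) _ = apex-x refl (shiftPos≢1 _)
firstDiffPos-isosceles (true ∷ x) (false ∷ y) (false ∷ z) _ = apex-x refl (shiftPos≢1 _)

lexLeq-total : ∀ {n} (x y : Bits n) → lexLeq x y ≡ false → lexLeq y x ≡ true
lexLeq-total [] [] ()
lexLeq-total (false ∷ x) (false ∷ y) e = lexLeq-total x y e
lexLeq-total (true ∷ x) (true ∷ y) e = lexLeq-total x y e
lexLeq-total (true ∷ x) (false ∷ y) e = refl

lexLeq-antisym : ∀ {n} (x y : Bits n) → lexLeq x y ≡ true → lexLeq y x ≡ true → x ≡ y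
lexLeq-antisym [] [] _ _ = refl
lexLeq-antisym (false ∷ x) (false ∷ y) e f = cong (false ∷_) (lexLeq-antisym x y e f)
lexLeq-antisym (true ∷ x) (true ∷ y) e f = cong (true ∷_) (lexLeq-antisym x y e f)

concat-injective : ∀ {A : Set} {m k} (xs ys : Vec (Vec A m) k) → concat xs ≡ concat ys → xs ≡ ys
concat-injective [] [] _ = refl
concat-injective (x ∷ xs) (y ∷ ys) e with ++-injective x y e
... | x≡y , rest = cong₂ _∷_ x≡y (concat-injective xs ys rest)

φ-sym : ∀ {m} (x y : Vertex m) → φ x y ≡ φ y x
φ-sym x y with vLeq x y in x≤y | vLeq y x in y≤x
... | true | true rewrite concat-injective x y (lexLeq-antisym (concat x) (concat y) x≤y y≤x) = refl
... | true | false = refl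
... | false | true = refl
... | false | false with () ← trans (sym (lexLeq-total (concat x) (concat y) x≤y)) y≤x

sortPair-≐ : ∀ {m} (u w : Bits m) → sortPair u w ≐ (u , w)
sortPair-≐ u w with lexLeq u w
... | true = inj₁ (refl , refl)
... | false = inj₂ (refl , refl)

firstDiffBlock-spec : ∀ {m k} (xs ys : Vec (Bits m) k) n → xs ≢ ys →
  ∃ λ i → lookup xs i ≢ lookup ys i ×
          firstDiffBlock xs ys n ≡ just (toℕ i + n , sortPair (lookup xs i) (lookup ys i))
firstDiffBlock-spec [] [] n xs≢ys = ⊥-elim (xs≢ys refl)
firstDiffBlock-spec (u ∷ xs) (w ∷ ys) n xs≢ys with ≡-dec _≟B_ u w
... | no u≢w = 0F , u≢w , refl
... | yes refl with firstDiffBlock-spec xs ys (suc n) (xs≢ys ∘ cong (u ∷_))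
...   | i , differ , spec =
  fs i , differ ,
  trans spec (cong (λ j → just (j , sortPair (lookup xs i) (lookup ys i))) (+-suc (toℕ i) n))

φ-firstBlock : ∀ {m} (x y : Vertex m) → x ≢ y →
  ∃ λ i → lookup x i ≢ lookup y i ×
          ∃ λ P → proj₁ (φ x y) ≡ just (toℕ i + 1 , P) × P ≐ (lookup x i , lookup y i)
φ-firstBlock x y x≢y with vLeq x y
... | true with firstDiffBlock-spec x y 1 x≢y
...   | i , differ , spec = i , differ , _ , spec , sortPair-≐ _ _
φ-firstBlock x y x≢y | false with firstDiffBlock-spec y x 1 (x≢y ∘ sym)
...   | i , differ , spec = i , differ ∘ sym , _ , spec , ≐-trans (sortPair-≐ _ _) ≐-flip

φ≡⇒firstBlock≐ : ∀ {m} {x y z w : Vertex m} → x ≢ y → z ≢ w → φ x y ≡ φ z w →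
  ∃ λ i → lookup x i ≢ lookup y i × (lookup x i , lookup y i) ≐ (lookup z i , lookup w i)
φ≡⇒firstBlock≐ {x = x} {y} {z} {w} x≢y z≢w same
  with φ-firstBlock x y x≢y | φ-firstBlock z w z≢w
... | i , differ , P , eq₁ , P≐ | j , _ , Q , eq₂ , Q≐
  with ,-injective (just-injective (trans (sym eq₁) (trans (cong proj₁ same) eq₂)))
... | i+1≡j+1 , refl with toℕ-injective {i = i} {j} (+-cancelʳ-≡ 1 _ _ i+1≡j+1)
... | refl = i , differ , ≐-trans (≐-sym P≐) Q≐

firstDiffPos-in-φ : ∀ {m} (x y : Vertex m) i →
  lookup (proj₁ (proj₂ (φ x y))) i ≡ firstDiffPos (lookup x i) (lookup y i)
firstDiffPos-in-φ x y i with vLeq x y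
... | true = lookup-zipWith firstDiffPos i x y
... | false = trans (lookup-zipWith firstDiffPos i y x) (firstDiffPos-sym (lookup y i) (lookup x i))

φ≡⇒firstDiffPos≡ : ∀ {m} {x y z w : Vertex m} → φ x y ≡ φ z w → ∀ i →
  firstDiffPos (lookup x i) (lookup y i) ≡ firstDiffPos (lookup z i) (lookup w i)
φ≡⇒firstDiffPos≡ {x = x} {y} {z} {w} same i = begin
  firstDiffPos (lookup x i) (lookup y i)  ≡⟨ firstDiffPos-in-φ x y i ⟨
  lookup (proj₁ (proj₂ (φ x y))) i        ≡⟨ cong (λ c → lookup (proj₁ (proj₂ c)) i) same ⟩
  lookup (proj₁ (proj₂ (φ z w))) i        ≡⟨ firstDiffPos-in-φ z w i ⟩
  firstDiffPos (lookup z i) (lookup w i)  ∎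
  where open ≡-Reasoning

injective⇒surjective : ∀ {n} {f : Fin n → Fin n} → Injective _≡_ _≡_ f → ∀ y → ∃ λ x → f x ≡ y
injective⇒surjective {suc n} {f} f-injective y with any? (λ x → f x ≟ y)
... | yes hit = hit
... | no miss = contradiction (injective⇒≤ {f = λ x → punchOut (avoids x)} squeezed) 1+n≰n
  where
  avoids : ∀ x → y ≢ f x
  avoids x y≡fx = miss (x , sym y≡fx)

  squeezed : Injective _≡_ _≡_ (λ x → punchOut (avoids x))
  squeezed e = f-injective (punchOut-injective (avoids _) (avoids _) e)

injective⇒permutation : ∀ {n} (f : Fin n → Fin n) → Injective _≡_ _≡_ f → Permutation′ n
injective⇒permutation f f-injective =
  permutation f (proj₁ ∘ onto) (proj₂ ∘ onto) (λ x → f-injective (proj₂ (onto (f x))))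
  where
  onto = injective⇒surjective f-injective

injective⇒missing : ∀ {m n} {f : Fin m → Fin n} → m < n → Injective _≡_ _≡_ f → ∃ λ y → ∀ x → f x ≢ y
injective⇒missing {m} {n} {f} m<n f-injective with any? (λ y → all? (λ x → ¬? (f x ≟ y)))
... | yes missed = missed
... | no ¬missed = contradiction (injective⇒≤ {f = preimage} preimage-injective) (<⇒≱ m<n)
  where
  hit : ∀ y → ∃ λ x → f x ≡ y
  hit y with any? (λ x → f x ≟ y)
  ... | yes h = h
  ... | no ¬h = ⊥-elim (¬missed (y , λ x fx≡y → ¬h (x , fx≡y)))

  preimage : Fin n → Fin m
  preimage = proj₁ ∘ hit

  preimage-injective : Injective _≡_ _≡_ preimage
  preimage-injective {y} {y'} e = trans (sym (proj₂ (hit y))) (trans (cong f e) (proj₂ (hit y')))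

∷-injective : ∀ {n k} {x : Fin n} {xs : Vec (Fin n) k} → (∀ i → lookup xs i ≢ x) →
              Injective _≡_ _≡_ (lookup xs) → Injective _≡_ _≡_ (lookup (x ∷ xs))
∷-injective fresh xs-injective {0F} {0F} _ = refl
∷-injective fresh xs-injective {0F} {fs j} x≡xⱼ = ⊥-elim (fresh j (sym x≡xⱼ))
∷-injective fresh xs-injective {fs i} {0F} xᵢ≡x = ⊥-elim (fresh i xᵢ≡x)
∷-injective fresh xs-injective {fs i} {fs j} xᵢ≡xⱼ = cong fs (xs-injective xᵢ≡xⱼ)

distinct₄ : ∀ {n} {a b c d : Fin n} → a ≢ b → a ≢ c → a ≢ d → b ≢ c → b ≢ d → c ≢ d →
            Injective _≡_ _≡_ (lookup (a ∷ b ∷ c ∷ d ∷ []))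
distinct₄ {a = a} {b} {c} {d} a≢b a≢c a≢d b≢c b≢d c≢d =
  ∷-injective {xs = b ∷ c ∷ d ∷ []} (λ { 0F → a≢b ∘ sym ; 1F → a≢c ∘ sym ; 2F → a≢d ∘ sym })
  (∷-injective {xs = c ∷ d ∷ []} (λ { 0F → b≢c ∘ sym ; 1F → b≢d ∘ sym })
  (∷-injective {xs = d ∷ []} (λ { 0F → c≢d ∘ sym })
  (∷-injective {xs = []} (λ ()) λ { {()} })))

Edge : Set
Edge = Fin 5 × Fin 5

_≐?_ : (e e' : Edge) → Dec (e ≐ e')
(s , t) ≐? (s' , t') = (s ≟ s' ×-dec t ≟ t') ⊎-dec (s ≟ t' ×-dec t ≟ s')

next5≢ : ∀ k → k ≢ next5 k
next5≢ 0F ()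
next5≢ 1F ()
next5≢ 2F ()
next5≢ 3F ()
next5≢ 4F ()

record PairColouring (C : Set) : Set where
  field
    colour : Fin 5 → Fin 5 → C
    colour-sym : ∀ s t → colour s t ≡ colour t s
    partner : ∀ s t → s ≢ t → ∃₂ λ s' t' → s' ≢ t' × ¬ (s , t) ≐ (s' , t') × colour s t ≡ colour s' t' ×
      (∀ s'' t'' → s'' ≢ t'' → colour s t ≡ colour s'' t'' →
                   (s , t) ≐ (s'' , t'') ⊎ (s' , t') ≐ (s'' , t''))

open PairColouring

RainbowCycle : ∀ {C} → PairColouring C → (Fin 5 → Fin 5) → Set
RainbowCycle P τ = Injective _≡_ _≡_ τ ×
  (∀ k l → k ≢ l → colour P (τ k) (τ (next5 k)) ≢ colour P (τ l) (τ (next5 l)))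

module _ {C : Set} (P : PairColouring C) where

  colour-≐ : ∀ {s t s' t'} → (s , t) ≐ (s' , t') → colour P s t ≡ colour P s' t'
  colour-≐ (inj₁ (refl , refl)) = refl
  colour-≐ (inj₂ (refl , refl)) = colour-sym P _ _

  colour-class : ∀ {s t s' t' s'' t''} → s ≢ t → s' ≢ t' → s'' ≢ t'' → ¬ (s , t) ≐ (s' , t') →
    colour P s t ≡ colour P s' t' → colour P s'' t'' ≡ colour P s t →
    (s'' , t'') ≐ (s , t) ⊎ (s'' , t'') ≐ (s' , t')
  colour-class {s} {t} {s'} {t'} {s''} {t''} s≢t s'≢t' s''≢t'' distinct same same''
    with partner P s t s≢t
  ... | s₁ , t₁ , _ , _ , _ , at-most-two with at-most-two s' t' s'≢t' same
  ... | inj₁ e≐e' = ⊥-elim (distinct e≐e')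
  ... | inj₂ e₁≐e' with at-most-two s'' t'' s''≢t'' (sym same'')
  ... | inj₁ e≐e'' = inj₁ (≐-sym e≐e'')
  ... | inj₂ e₁≐e'' = inj₂ (≐-trans (≐-sym e₁≐e'') e₁≐e')

relabel : ∀ {C} → Permutation′ 5 → PairColouring C → PairColouring C
relabel π P = record
  { colour = λ s t → colour P (π ⟨$⟩ʳ s) (π ⟨$⟩ʳ t)
  ; colour-sym = λ s t → colour-sym P _ _
  ; partner = partner′
  }
  where
  π⁻¹π : ∀ {a b} → (π ⟨$⟩ˡ (π ⟨$⟩ʳ a) , π ⟨$⟩ˡ (π ⟨$⟩ʳ b)) ≡ (a , b)
  π⁻¹π = cong₂ _,_ (inverseˡ π) (inverseˡ π)

  ππ⁻¹ : ∀ {a b} → (π ⟨$⟩ʳ (π ⟨$⟩ˡ a) , π ⟨$⟩ʳ (π ⟨$⟩ˡ b)) ≡ (a , b)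
  ππ⁻¹ = cong₂ _,_ (inverseʳ π) (inverseʳ π)

  π-injective : ∀ {s t} → π ⟨$⟩ʳ s ≡ π ⟨$⟩ʳ t → s ≡ t
  π-injective e = trans (sym (inverseˡ π)) (trans (cong (π ⟨$⟩ˡ_) e) (inverseˡ π))

  π⁻¹-injective : ∀ {u v} → π ⟨$⟩ˡ u ≡ π ⟨$⟩ˡ v → u ≡ v
  π⁻¹-injective e = trans (sym (inverseʳ π)) (trans (cong (π ⟨$⟩ʳ_) e) (inverseʳ π))

  partner′ : ∀ s t → s ≢ t → _
  partner′ s t s≢t with partner P (π ⟨$⟩ʳ s) (π ⟨$⟩ʳ t) (s≢t ∘ π-injective)
  ... | u , v , u≢v , distinct , same , at-most-two =
    π ⟨$⟩ˡ u , π ⟨$⟩ˡ v , u≢v ∘ π⁻¹-injective ,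
    (λ e → distinct (subst (_ ≐_) ππ⁻¹ (≐-map (π ⟨$⟩ʳ_) e))) ,
    trans same (sym (cong (λ (a , b) → colour P a b) ππ⁻¹)) ,
    λ s'' t'' s''≢t'' same'' → Data.Sum.map
      (λ e → subst₂ _≐_ π⁻¹π π⁻¹π (≐-map (π ⟨$⟩ˡ_) e))
      (λ e → subst (_ ≐_) π⁻¹π (≐-map (π ⟨$⟩ˡ_) e))
      (at-most-two _ _ (s''≢t'' ∘ π-injective) same'')

relabel-rainbow : ∀ {C} (π : Permutation′ 5) (P : PairColouring C) {τ} → RainbowCycle P τ →
                  RainbowCycle (relabel π P) ((π ⟨$⟩ˡ_) ∘ τ)
relabel-rainbow π P {τ} (τ-injective , rainbow) =
  (λ e → τ-injective (trans (sym (inverseʳ π)) (trans (cong (π ⟨$⟩ʳ_) e) (inverseʳ π)))) ,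
  λ k l k≢l same → rainbow k l k≢l (trans (colour-back k) (trans same (sym (colour-back l))))
  where
  colour-back : ∀ k →
    colour P (τ k) (τ (next5 k)) ≡ colour (relabel π P) (π ⟨$⟩ˡ τ k) (π ⟨$⟩ˡ τ (next5 k))
  colour-back k = sym (cong₂ (colour P) (inverseʳ π) (inverseʳ π))

length-≤-by-colour : ∀ {A B C : Set} (c : A → C) (d : B → C) {xs : List A} {ys : List B} →
  AllPairs (λ x x' → c x ≢ c x') xs → All (λ x → Any (λ y → c x ≡ d y) ys) xs → length xs ≤ length ys
length-≤-by-colour c d [] [] = z≤n
length-≤-by-colour c d {x ∷ xs} {ys} (x-fresh ∷ xs-distinct) (hit ∷ hits) = begin
  suc (length xs)          ≤⟨ s≤s (length-≤-by-colour c d xs-distinct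
                                 (All.zipWith (λ (x≢ , hit′) → avoid hit hit′ x≢) (x-fresh , hits))) ⟩
  suc (length (ys ─ hit))  ≡⟨ length-removeAt′ ys (Any.index hit) ⟨
  length ys                ∎
  where
  open ≤-Reasoning
  avoid : ∀ {x' ys} (p : Any (λ y → c x ≡ d y) ys) → Any (λ y → c x' ≡ d y) ys → c x ≢ c x' →
          Any (λ y → c x' ≡ d y) (ys ─ p)
  avoid (here e) (here e') x≢x' = ⊥-elim (x≢x' (trans e (sym e')))
  avoid (here _) (there q) _ = q
  avoid (there _) (here e') _ = here e'
  avoid (there p) (there q) x≢x' = there (avoid p q x≢x')

ascending? : (e : Edge) → Dec (proj₁ e Fin.< proj₂ e)
ascending? e = proj₁ e Fin.<? proj₂ e

edges : List Edge
edges = filter ascending? (cartesianProduct (allFin 5) (allFin 5))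

edges-complete : ∀ {s t} → s ≢ t → ∃ λ e → e ∈ edges × e ≐ (s , t)
edges-complete {s} {t} s≢t with <-cmp s t
... | tri< s<t _ _ =
  (s , t) , ∈-filter⁺ ascending? (∈-cartesianProduct⁺ (∈-allFin s) (∈-allFin t)) s<t , ≐-refl
... | tri≈ _ s≡t _ = ⊥-elim (s≢t s≡t)
... | tri> _ _ t<s =
  (t , s) , ∈-filter⁺ ascending? (∈-cartesianProduct⁺ (∈-allFin t) (∈-allFin s)) t<s , ≐-flip

≢-≐ : ∀ {s t s' t' : Fin 5} → (s , t) ≐ (s' , t') → s' ≢ t' → s ≢ t
≢-≐ (inj₁ (refl , refl)) s'≢t' = s'≢t'
≢-≐ (inj₂ (refl , refl)) s'≢t' = s'≢t' ∘ sym

EdgeSet : Set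
EdgeSet = Fin 5 → Fin 5 → Bool

ColourInvariant : ∀ {C} → PairColouring C → EdgeSet → Set
ColourInvariant P S = ∀ {s t s' t'} → s ≢ t → s' ≢ t' → colour P s t ≡ colour P s' t' → S s t ≡ S s' t'

cycleEdge : (Fin 5 → Fin 5) → Fin 5 → Edge
cycleEdge τ k = τ k , τ (next5 k)

OnCycle : (Fin 5 → Fin 5) → Edge → Set
OnCycle τ e = ∃ λ k → cycleEdge τ k ≐ e

onCycle? : ∀ τ (e : Edge) → Dec (OnCycle τ e)
onCycle? τ e = any? λ k → cycleEdge τ k ≐? e

cycleEdgeIn? : ∀ (τ : Fin 5 → Fin 5) (S : EdgeSet) k → Dec (T (S (τ k) (τ (next5 k))))
cycleEdgeIn? τ S k = T? (S (τ k) (τ (next5 k)))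

offCycleEdgeIn? : ∀ τ (S : EdgeSet) (e : Edge) → Dec (T (S (proj₁ e) (proj₂ e)) × ¬ OnCycle τ e)
offCycleEdgeIn? τ S e = T? (S (proj₁ e) (proj₂ e)) ×-dec ¬? (onCycle? τ e)

cycleEdgesIn : (Fin 5 → Fin 5) → EdgeSet → List (Fin 5)
cycleEdgesIn τ S = filter (cycleEdgeIn? τ S) (allFin 5)

offCycleEdgesIn : (Fin 5 → Fin 5) → EdgeSet → List Edge
offCycleEdgesIn τ S = filter (offCycleEdgeIn? τ S) edges

-- The partners of the cycle edges lie off the cycle and are pairwise distinct.
rainbow-halves : ∀ {C} (P : PairColouring C) {S} → ColourInvariant P S → ∀ {τ} → RainbowCycle P τ →
                 length (cycleEdgesIn τ S) ≤ length (offCycleEdgesIn τ S)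
rainbow-halves {C} P {S} S-invariant {τ} (τ-injective , rainbow) =
  length-≤-by-colour cycleColour edgeColour
    (AllPairs.filter⁺ (cycleEdgeIn? τ S) (AllPairs.map (rainbow _ _) (allFin⁺ 5)))
    (All.map partner-off-cycle (all-filter (cycleEdgeIn? τ S) (allFin 5)))
  where
  cycleColour : Fin 5 → C
  cycleColour k = colour P (τ k) (τ (next5 k))

  edgeColour : Edge → C
  edgeColour e = colour P (proj₁ e) (proj₂ e)

  partner-off-cycle : ∀ {k} → T (S (τ k) (τ (next5 k))) →
                      Any (λ e → cycleColour k ≡ edgeColour e) (offCycleEdgesIn τ S)
  partner-off-cycle {k} k∈S with partner P (τ k) (τ (next5 k)) (next5≢ k ∘ τ-injective)
  ... | s' , t' , s'≢t' , distinct , same , _ with edges-complete s'≢t'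
  ... | e , e∈edges , e≐ = lose (∈-filter⁺ (offCycleEdgeIn? τ S) e∈edges (e∈S , off-cycle)) same′
    where
    same′ : cycleColour k ≡ edgeColour e
    same′ = trans same (colour-≐ P (≐-sym e≐))

    e∈S : T (S (proj₁ e) (proj₂ e))
    e∈S = subst T (S-invariant (next5≢ k ∘ τ-injective) (≢-≐ e≐ s'≢t') same′) k∈S

    off-cycle : ¬ OnCycle τ e
    off-cycle (l , l≐e) = rainbow l k l≢k (trans (colour-≐ P l≐e) (sym same′))
      where
      l≢k : l ≢ k
      l≢k refl = distinct (≐-trans l≐e e≐)

Unbalanced : (Fin 5 → Fin 5) → EdgeSet → Set
Unbalanced τ S = length (offCycleEdgesIn τ S) < length (cycleEdgesIn τ S)

unbalanced? : ∀ τ S → Dec (Unbalanced τ S)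
unbalanced? τ S = length (offCycleEdgesIn τ S) <? length (cycleEdgesIn τ S)

Unbalances : List EdgeSet → (Fin 5 → Fin 5) → Set
Unbalances Ss τ = Injective _≡_ _≡_ τ → Any (Unbalanced τ) Ss

injective? : (τ : Fin 5 → Fin 5) → Dec (Injective _≡_ _≡_ τ)
injective? τ = map′ (λ h {i} {j} → h i j) (λ h i j → h) (all? λ i → all? λ j → τ i ≟ τ j →-dec i ≟ j)

unbalances? : ∀ Ss τ → Dec (Unbalances Ss τ)
unbalances? Ss τ = injective? τ →-dec Any.any? (unbalanced? τ) Ss

cycleOf : Fin 5 → Fin 5 → Fin 5 → Fin 5 → Fin 5 → Fin 5 → Fin 5
cycleOf x₀ x₁ x₂ x₃ x₄ = lookup (x₀ ∷ x₁ ∷ x₂ ∷ x₃ ∷ x₄ ∷ [])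

EveryCycle : ((Fin 5 → Fin 5) → Set) → Set
EveryCycle Q = ∀ x₀ x₁ x₂ x₃ x₄ → Q (cycleOf x₀ x₁ x₂ x₃ x₄)

everyCycle? : ∀ {Q} → (∀ τ → Dec (Q τ)) → Dec (EveryCycle Q)
everyCycle? Q? = all? λ x₀ → all? λ x₁ → all? λ x₂ → all? λ x₃ → all? λ x₄ → Q? (cycleOf x₀ x₁ x₂ x₃ x₄)

RainbowCycle-≗ : ∀ {C} (P : PairColouring C) {τ τ′} → (∀ k → τ k ≡ τ′ k) →
                 RainbowCycle P τ → RainbowCycle P τ′
RainbowCycle-≗ P {τ} {τ′} τ≗τ′ (τ-injective , rainbow) =
  (λ {i} {j} e → τ-injective (trans (τ≗τ′ i) (trans e (sym (τ≗τ′ j))))) ,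
  λ k l k≢l same → rainbow k l k≢l (trans (colour≗ k) (trans same (sym (colour≗ l))))
  where
  colour≗ : ∀ k → colour P (τ k) (τ (next5 k)) ≡ colour P (τ′ k) (τ′ (next5 k))
  colour≗ k = cong₂ (colour P) (τ≗τ′ k) (τ≗τ′ (next5 k))

cycleOf-η : ∀ (τ : Fin 5 → Fin 5) k → τ k ≡ cycleOf (τ 0F) (τ 1F) (τ 2F) (τ 3F) (τ 4F) k
cycleOf-η τ 0F = refl
cycleOf-η τ 1F = refl
cycleOf-η τ 2F = refl
cycleOf-η τ 3F = refl
cycleOf-η τ 4F = refl

no-rainbow-if-unbalanced : ∀ {C} (P : PairColouring C) {Ss} → All (ColourInvariant P) Ss →
                           EveryCycle (Unbalances Ss) → ∀ {τ} → ¬ RainbowCycle P τ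
no-rainbow-if-unbalanced P invariant every {τ} rainbow-τ =
  All.lookupWith
    (λ {S} (S-invariant : ColourInvariant P S) unbalanced →
       <⇒≱ unbalanced (rainbow-halves P S-invariant rainbow))
    invariant (every (τ 0F) (τ 1F) (τ 2F) (τ 3F) (τ 4F) (proj₁ rainbow))
  where
  rainbow = RainbowCycle-≗ P (cycleOf-η τ) rainbow-τ

inPair? : ∀ e e' (x : Edge) → Dec (x ≐ e ⊎ x ≐ e')
inPair? e e' x = x ≐? e ⊎-dec x ≐? e'

pairSet : Edge → Edge → EdgeSet
pairSet e e' s t = does (inPair? e e' (s , t))

module _ {C : Set} (P : PairColouring C) where

  ∧-invariant : ∀ {S S'} → ColourInvariant P S → ColourInvariant P S' →
                ColourInvariant P (λ s t → S s t ∧ S' s t)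
  ∧-invariant S-inv S'-inv s≢t s'≢t' same = cong₂ _∧_ (S-inv s≢t s'≢t' same) (S'-inv s≢t s'≢t' same)

  not-invariant : ∀ {S} → ColourInvariant P S → ColourInvariant P (λ s t → not (S s t))
  not-invariant S-inv s≢t s'≢t' same = cong not (S-inv s≢t s'≢t' same)

  pairSet-invariant : ∀ {a b c d} → a ≢ b → c ≢ d → ¬ (a , b) ≐ (c , d) → colour P a b ≡ colour P c d →
                      ColourInvariant P (pairSet (a , b) (c , d))
  pairSet-invariant {a} {b} {c} {d} a≢b c≢d distinct same {s} {t} {s'} {t'} s≢t s'≢t' same′ =
    does-⇔ (mk⇔ (stay s'≢t' same′) (stay s≢t (sym same′))) (inPair? _ _ (s , t)) (inPair? _ _ (s' , t'))
    where
    in-class : ∀ {u v} → (u , v) ≐ (a , b) ⊎ (u , v) ≐ (c , d) → colour P u v ≡ colour P a b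
    in-class (inj₁ uv≐ab) = colour-≐ P uv≐ab
    in-class (inj₂ uv≐cd) = trans (colour-≐ P uv≐cd) (sym same)

    stay : ∀ {u v u' v'} → u' ≢ v' → colour P u v ≡ colour P u' v' →
           (u , v) ≐ (a , b) ⊎ (u , v) ≐ (c , d) → (u' , v') ≐ (a , b) ⊎ (u' , v') ≐ (c , d)
    stay u'≢v' same-uv uv∈ =
      colour-class P a≢b c≢d u'≢v' distinct same (trans (sym same-uv) (in-class uv∈))

data Kind : Set where
  α β γ : Kind

-- Normal form of the configuration: the matched edges are 12 and 34, vertices 1 and 3 carry
-- block α, vertices 2 and 4 carry block β, and the fifth vertex 0 carries block γ.
kind : Fin 5 → Kind
kind 0F = γ
kind 1F = α
kind 2F = β
kind 3F = α
kind 4F = β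

sameKindᵏ : Kind → Kind → Bool
sameKindᵏ α α = true
sameKindᵏ β β = true
sameKindᵏ γ γ = true
sameKindᵏ _ _ = false

mixedᵏ : Kind → Kind → Bool
mixedᵏ α β = true
mixedᵏ β α = true
mixedᵏ _ _ = false

isβ : Kind → Bool
isβ β = true
isβ _ = false

sameKind joinsαβ crossesβ matched crossMatched : EdgeSet
sameKind s t = sameKindᵏ (kind s) (kind t)
joinsαβ s t = mixedᵏ (kind s) (kind t)
crossesβ s t = isβ (kind s) xor isβ (kind t)
matched = pairSet (1F , 2F) (3F , 4F)
crossMatched s t = joinsαβ s t ∧ not (matched s t)

-- sameKind, matched and crossMatched are the perfect matchings {13, 24}, {12, 34}, {14, 23};
-- deleting 0 from a Hamiltonian cycle leaves a path whose end edges form one of them.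
perfectMatchings : List EdgeSet
perfectMatchings = sameKind ∷ matched ∷ crossMatched ∷ []

-- A Hamiltonian cycle crosses between {2, 4} and {0, 1, 3} an even number of times, so it uses
-- four of the six crossing edges or three of the other four edges.
βCrossing : List EdgeSet
βCrossing = crossesβ ∷ (λ s t → not (crossesβ s t)) ∷ []

perfectMatchings-unbalanced : EveryCycle (Unbalances perfectMatchings)
perfectMatchings-unbalanced = from-yes (everyCycle? (unbalances? perfectMatchings))

βCrossing-unbalanced : EveryCycle (Unbalances βCrossing)
βCrossing-unbalanced = from-yes (everyCycle? (unbalances? βCrossing))

RecordsFirstDiff : ∀ {C} → PairColouring C → ∀ {m} → (Fin 5 → Bits m) → Set
RecordsFirstDiff P g = ∀ {s t s' t'} → colour P s t ≡ colour P s' t' →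
                       firstDiffPos (g s) (g t) ≡ firstDiffPos (g s') (g t')

module Configuration {C : Set} (P : PairColouring C) {m} (g : Fin 5 → Bits m)
         (records : RecordsFirstDiff P g)
         (g₁≡g₃ : g 1F ≡ g 3F) (g₂≡g₄ : g 2F ≡ g 4F) (g₁≢g₂ : g 1F ≢ g 2F) where

  block : Kind → Bits m
  block α = g 1F
  block β = g 2F
  block γ = g 0F

  g≡block : ∀ v → g v ≡ block (kind v)
  g≡block 0F = refl
  g≡block 1F = refl
  g≡block 2F = refl
  g≡block 3F = sym g₁≡g₃
  g≡block 4F = sym g₂≡g₄

  p q r : ℕ
  p = firstDiffPos (g 1F) (g 2F)
  q = firstDiffPos (g 0F) (g 1F)
  r = firstDiffPos (g 0F) (g 2F)

  dist : Kind → Kind → ℕ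
  dist α α = 0
  dist α β = p
  dist α γ = q
  dist β α = p
  dist β β = 0
  dist β γ = r
  dist γ α = q
  dist γ β = r
  dist γ γ = 0

  dist-correct : ∀ k k' → firstDiffPos (block k) (block k') ≡ dist k k'
  dist-correct α α = firstDiffPos-self (g 1F)
  dist-correct α β = refl
  dist-correct α γ = firstDiffPos-sym (g 1F) (g 0F)
  dist-correct β α = firstDiffPos-sym (g 2F) (g 1F)
  dist-correct β β = firstDiffPos-self (g 2F)
  dist-correct β γ = firstDiffPos-sym (g 2F) (g 0F)
  dist-correct γ α = refl
  dist-correct γ β = refl
  dist-correct γ γ = firstDiffPos-self (g 0F)

  invariant-by-kind : (T : Kind → Kind → Bool) (h : ℕ → Bool) → (∀ k k' → T k k' ≡ h (dist k k')) →
                      ColourInvariant P (λ s t → T (kind s) (kind t))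
  invariant-by-kind T h T≡h {s} {t} {s'} {t'} _ _ same = begin
    T (kind s) (kind t)             ≡⟨ T≡h (kind s) (kind t) ⟩
    h (dist (kind s) (kind t))      ≡⟨ cong h (distance s t) ⟨
    h (firstDiffPos (g s) (g t))    ≡⟨ cong h (records same) ⟩
    h (firstDiffPos (g s') (g t'))  ≡⟨ cong h (distance s' t') ⟩
    h (dist (kind s') (kind t'))    ≡⟨ T≡h (kind s') (kind t') ⟨
    T (kind s') (kind t')           ∎
    where
    open ≡-Reasoning
    distance : ∀ s t → firstDiffPos (g s) (g t) ≡ dist (kind s) (kind t)
    distance s t = trans (cong₂ firstDiffPos (g≡block s) (g≡block t)) (dist-correct (kind s) (kind t))

  is : ∀ {x y} → x ≡ y → true ≡ does (x ℕ.≟ y)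
  is x≡y = sym (dec-true (_ ℕ.≟ _) x≡y)

  isn't : ∀ {x y} → x ≢ y → false ≡ does (x ℕ.≟ y)
  isn't x≢y = sym (dec-false (_ ℕ.≟ _) x≢y)

  p≟p : true ≡ does (p ℕ.≟ p)
  p≟p = is {p} refl

  p≢0 : p ≢ 0
  p≢0 = g₁≢g₂ ∘ firstDiffPos≡0⇒≡ _ _

  0≢p : 0 ≢ p
  0≢p = p≢0 ∘ sym

  no-rainbow-apex-γ : colour P 1F 2F ≡ colour P 3F 4F → q ≡ r → q ≢ p → ∀ {τ} → ¬ RainbowCycle P τ
  no-rainbow-apex-γ matching q≡r q≢p =
    no-rainbow-if-unbalanced P (sameKind-invariant ∷ matched-invariant ∷
                  ∧-invariant P joinsαβ-invariant (not-invariant P matched-invariant) ∷ [])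
      perfectMatchings-unbalanced
    where
    q≢0 : q ≢ 0
    q≢0 q≡0 = g₁≢g₂ (trans (sym (firstDiffPos≡0⇒≡ (g 0F) (g 1F) q≡0))
                                (firstDiffPos≡0⇒≡ (g 0F) (g 2F) (trans (sym q≡r) q≡0)))

    r≢0 : r ≢ 0
    r≢0 = q≢0 ∘ trans q≡r

    r≢p : r ≢ p
    r≢p = q≢p ∘ trans q≡r

    sameKind-invariant : ColourInvariant P sameKind
    sameKind-invariant = invariant-by-kind sameKindᵏ (λ n → does (n ℕ.≟ 0)) λ where
      α α → refl
      α β → isn't p≢0
      α γ → isn't q≢0
      β α → isn't p≢0
      β β → refl
      β γ → isn't r≢0
      γ α → isn't q≢0
      γ β → isn't r≢0
      γ γ → refl

    joinsαβ-invariant : ColourInvariant P joinsαβ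
    joinsαβ-invariant = invariant-by-kind mixedᵏ (λ n → does (n ℕ.≟ p)) λ where
      α α → isn't 0≢p
      α β → p≟p
      α γ → isn't q≢p
      β α → p≟p
      β β → isn't 0≢p
      β γ → isn't r≢p
      γ α → isn't q≢p
      γ β → isn't r≢p
      γ γ → isn't 0≢p

    matched-invariant : ColourInvariant P matched
    matched-invariant =
      pairSet-invariant P (λ ()) (λ ()) (λ { (inj₁ (() , _)) ; (inj₂ (() , _)) }) matching

  no-rainbow-apex-β : r ≡ p → q ≢ p → ∀ {τ} → ¬ RainbowCycle P τ
  no-rainbow-apex-β r≡p q≢p =
    no-rainbow-if-unbalanced P (crossesβ-invariant ∷ not-invariant P crossesβ-invariant ∷ [])
      βCrossing-unbalanced
    where
    crossesβ-invariant : ColourInvariant P crossesβ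
    crossesβ-invariant = invariant-by-kind (λ k k' → isβ k xor isβ k') (λ n → does (n ℕ.≟ p)) λ where
      α α → isn't 0≢p
      α β → p≟p
      α γ → isn't q≢p
      β α → p≟p
      β β → isn't 0≢p
      β γ → is r≡p
      γ α → isn't q≢p
      γ β → is r≡p
      γ γ → isn't 0≢p

swapαβ : Fin 5 → Fin 5
swapαβ 0F = 0F
swapαβ 1F = 2F
swapαβ 2F = 1F
swapαβ 3F = 4F
swapαβ 4F = 3F

swapαβ-involutive : ∀ v → swapαβ (swapαβ v) ≡ v
swapαβ-involutive 0F = refl
swapαβ-involutive 1F = refl
swapαβ-involutive 2F = refl
swapαβ-involutive 3F = refl
swapαβ-involutive 4F = refl

no-rainbow-normal : ∀ {C} (P : PairColouring C) {m} (g : Fin 5 → Bits m) → RecordsFirstDiff P g →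
  colour P 1F 2F ≡ colour P 3F 4F → g 1F ≡ g 3F → g 2F ≡ g 4F → g 1F ≢ g 2F → ∀ {τ} → ¬ RainbowCycle P τ
no-rainbow-normal P g records matching g₁≡g₃ g₂≡g₄ g₁≢g₂
  with firstDiffPos-isosceles (g 1F) (g 2F) (g 0F) g₁≢g₂
... | apex-z q≡r q≢p = Configuration.no-rainbow-apex-γ P g records g₁≡g₃ g₂≡g₄ g₁≢g₂ matching q≡r q≢p
... | apex-y r≡p q≢p = Configuration.no-rainbow-apex-β P g records g₁≡g₃ g₂≡g₄ g₁≢g₂ r≡p q≢p
-- swapping α and β turns apex α into apex β
... | apex-x q≡p r≢p = λ rainbow →
  Configuration.no-rainbow-apex-β (relabel π P) (g ∘ swapαβ) records g₂≡g₄ g₁≡g₃ (g₁≢g₂ ∘ sym)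
    (trans q≡p (firstDiffPos-sym (g 1F) (g 2F))) (λ e → r≢p (trans e (firstDiffPos-sym (g 2F) (g 1F))))
    (relabel-rainbow π P rainbow)
  where
  π = permutation swapαβ swapαβ swapαβ-involutive swapαβ-involutive

no-rainbow-through-matching : ∀ {C} (P : PairColouring C) {m} (g : Fin 5 → Bits m) →
  RecordsFirstDiff P g →
  ∀ {a b c d} → Injective _≡_ _≡_ (lookup (a ∷ b ∷ c ∷ d ∷ [])) →
  colour P a b ≡ colour P c d → g a ≡ g c → g b ≡ g d → g a ≢ g b → ∀ {τ} → ¬ RainbowCycle P τ
no-rainbow-through-matching P g records {a} {b} {c} {d} distinct matching ga≡gc gb≡gd ga≢gb rainbow
  with injective⇒missing (s≤s (s≤s (s≤s (s≤s (s≤s z≤n))))) distinct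
... | e , e-fresh =
  no-rainbow-normal (relabel π P) (g ∘ (π ⟨$⟩ʳ_)) records matching ga≡gc gb≡gd ga≢gb
    (relabel-rainbow π P rainbow)
  where
  π = injective⇒permutation (lookup (e ∷ a ∷ b ∷ c ∷ d ∷ [])) (∷-injective e-fresh distinct)

orient : ∀ {s t : Fin 5} → s ≢ t → Σ Edge5 λ e → (src e , tgt e) ≐ (s , t)
orient {s} {t} s≢t with <-cmp s t
... | tri< s<t _ _ = ((s , t) , s<t) , ≐-refl
... | tri≈ _ s≡t _ = ⊥-elim (s≢t s≡t)
... | tri> _ _ t<s = ((t , s) , t<s) , ≐-flip

≐⇒SameEdge : ∀ (e e' : Edge5) → (src e , tgt e) ≐ (src e' , tgt e') → SameEdge e e'
≐⇒SameEdge _ _ (inj₁ same) = same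
≐⇒SameEdge (_ , a<b) (_ , b<a) (inj₂ (refl , refl)) = ⊥-elim (<-asym a<b b<a)

pairColouring : ∀ {m} (f : Fin 5 → Vertex m) → Is22222 f → PairColouring (Color m)
pairColouring f is22 = record
  { colour = λ s t → φ (f s) (f t)
  ; colour-sym = λ s t → φ-sym (f s) (f t)
  ; partner = partner′
  }
  where
  φ-≐ : ∀ {s t s' t'} → (s , t) ≐ (s' , t') → φ (f s) (f t) ≡ φ (f s') (f t')
  φ-≐ (inj₁ (refl , refl)) = refl
  φ-≐ (inj₂ (refl , refl)) = φ-sym _ _

  partner′ : ∀ s t → s ≢ t → _
  partner′ s t s≢t with orient s≢t
  ... | e , e≐st with is22 e
  ... | e' , distinct , same , at-most-two =
    src e' , tgt e' , <⇒≢ (proj₂ e') ,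
    (λ st≐e' → distinct (≐⇒SameEdge e e' (≐-trans e≐st st≐e'))) ,
    trans (φ-≐ (≐-sym e≐st)) same ,
    λ s'' t'' s''≢t'' same'' → let (e'' , e''≐) = orient s''≢t'' in
      Data.Sum.map (λ e~e'' → ≐-trans (≐-sym e≐st) (≐-trans (inj₁ e~e'') e''≐))
                   (λ e'~e'' → ≐-trans (inj₁ e'~e'') e''≐)
                   (at-most-two e'' (trans (φ-≐ e≐st) (trans same'' (φ-≐ (≐-sym e''≐)))))

lemma10 : (m : ℕ) → 1 ≤ m → (f : Fin 5 → Vertex m) → Injective _≡_ _≡_ f →
          Is22222 f → HasRainbow5Cycle f → HasMatchingClass f → ⊥
lemma10 m _ f f-injective is22 (_ , rainbow)
        (((a , b) , a<b) , ((c , d) , c<d) , (a≢c , a≢d , b≢c , b≢d) , same) =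
  through-block (φ≡⇒firstBlock≐ (a≢b ∘ f-injective) (c≢d ∘ f-injective) same)
  where
  P = pairColouring f is22
  a≢b = <⇒≢ a<b
  c≢d = <⇒≢ c<d

  through-block : ∃ (λ i → lookup (f a) i ≢ lookup (f b) i ×
                    (lookup (f a) i , lookup (f b) i) ≐ (lookup (f c) i , lookup (f d) i)) → ⊥
  through-block (i , differ , inj₁ (ac , bd)) =
    no-rainbow-through-matching P (λ v → lookup (f v) i) (λ same → φ≡⇒firstDiffPos≡ same i)
      (distinct₄ a≢b a≢c a≢d b≢c b≢d c≢d) same ac bd differ rainbow
  through-block (i , differ , inj₂ (ad , bc)) =
    no-rainbow-through-matching P (λ v → lookup (f v) i) (λ same → φ≡⇒firstDiffPos≡ same i)
      (distinct₄ a≢b a≢d a≢c b≢d b≢c (c≢d ∘ sym)) (trans same (colour-sym P c d)) ad bc differ rainbow
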